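{- Let $p<q$ be positive integers with $q-p$ even, let $b=\frac{q-p}{2}$, and assume $p\ge 2b$. Then the set $\{p-2b+1,\dots,p\}\cup\{p+1,\dots,p+b\}$ is consistent with respect to the control sequence for $(p,q)$.
   Context: The control sequence for $(p,q)$ is the infinite sequence of brackets $\beta_1,\beta_2,\dots$, where $\beta_j\subseteq\{1,\dots,q\}$ consists of the numbers $(j-1)b+1,\dots,(j-1)b+p$, each reduced modulo $q$ into $\{1,\dots,q\}$. For $x\in\beta_j$, its occurrence number in bracket $j$ is $|\{j'\le j:x\in\beta_{j'}\}|$. Numbers $x,y$ are in contradiction in bracket $j$ if $x,y\in\beta_j$ and the occurrence number of $y$ in bracket $j$ equals that of $x$ plus $2$. A subset of $\{1,\dots,q\}$ is consistent if no two of its elements are in contradiction in any bracket. -}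

module Defs where

open import Data.Nat using (ℕ; zero; suc; _+_; _*_; _∸_; _≤_; _<_; NonZero)
open import Data.Nat.DivMod using (_%_)
open import Data.Bool using (Bool; true; false; _∨_; if_then_else_)
open import Data.Nat using (_≡ᵇ_)
open import Relation.Binary.PropositionalEquality using (_≡_; _≢_)
open import Data.Product using (_×_)

red : (q : ℕ) → .{{NonZero q}} → ℕ → ℕ
red q n = suc ((n ∸ 1) % q)

memAux : (q : ℕ) → .{{NonZero q}} → ℕ → ℕ → ℕ → Bool
memAux q start zero     x = false
memAux q start (suc k)  x = (red q (start + k) ≡ᵇ x) ∨ memAux q start k x

-- x ∈ β_j  for the control sequence of (p,q) with b = (q-p)/2, brackets j ≥ 1:
-- β_j = { red q ((j-1)b+1), …, red q ((j-1)b+p) }.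
inBracketᵇ : (p q b : ℕ) → .{{NonZero q}} → ℕ → ℕ → Bool
inBracketᵇ p q b j x = memAux q ((j ∸ 1) * b + 1) p x

InBracket : (p q b : ℕ) → .{{NonZero q}} → ℕ → ℕ → Set
InBracket p q b j x = inBracketᵇ p q b j x ≡ true

occ : (p q b : ℕ) → .{{NonZero q}} → ℕ → ℕ → ℕ
occ p q b zero    x = 0
occ p q b (suc j) x = (if inBracketᵇ p q b (suc j) x then 1 else 0) + occ p q b j x

InContradiction : (p q b : ℕ) → .{{NonZero q}} → ℕ → ℕ → ℕ → Set
InContradiction p q b j x y =
  InBracket p q b j x × InBracket p q b j y × (occ p q b j y ≡ occ p q b j x + 2)

Consistent : (p q b : ℕ) → .{{NonZero q}} → (ℕ → Set) → Set
Consistent p q b S =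
  ∀ x y j → S x → S y → 1 ≤ j → InContradiction p q b j x y → Data.Empty.⊥
  where import Data.Empty

TheSet : (p b : ℕ) → ℕ → Set
TheSet p b x = (p ∸ 2 * b + 1 ≤ x × x ≤ p) Data.Sum.⊎ (p + 1 ≤ x × x ≤ p + b)
  where import Data.Sum

-- Write c = q − x.  Bracket k + 1 is the window of p = q − 2b consecutive residues starting
-- at kb + 1, so it contains x exactly when the position (kb + c) mod q is at least 2b.  This
-- position advances by b per bracket, and each time it wraps around q it spends exactly two
-- brackets in the gap [0, 2b).  For x in the set, b ≤ c < 4b, so if bracket k + 1 contains x,
-- then 2L + [c < 2b] of the first k + 1 brackets miss x, where L = ⌊(kb + c)/q⌋ counts the
-- wraps.  If x and y both lie in a bracket and y has occurred twice more, parity gives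
-- [c_x < 2b] = [c_y < 2b] and L_x = L_y + 1, hence c_x − c_y > 2b; but c_x and c_y lie in the
-- same half [b, 2b) or [2b, 4b).
module Submission where

open import Defs
open import Data.Nat using (ℕ; NonZero; _+_; _*_; _≤_; _<_)
open import Relation.Binary.PropositionalEquality using (_≡_)

open import Data.Nat using (zero; suc; z≤n; s≤s; _≟_; _∸_; s≤s⁻¹; _≡ᵇ_; _<ᵇ_; _<?_; _/_; _%_)
open import Data.Nat.Properties
open import Data.Nat.DivMod
open import Data.Nat.Divisibility using (divides-refl)
open import Data.Nat.Tactic.RingSolver using (solve-∀)
open import Data.Bool using (true; false; _∨_; if_then_else_)
open import Data.Bool.Properties using (∨-zeroʳ; T-≡; ¬-not)
open import Data.Product using (_×_; _,_; proj₁; proj₂; uncurry; ∃-syntax)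
open import Data.Sum using (inj₁; inj₂)
open import Data.Empty using (⊥-elim)
open import Function.Bundles using (Equivalence)
open import Relation.Nullary using (¬_; yes; no)
open import Relation.Binary.PropositionalEquality using (refl; sym; trans; cong; cong₂; subst; module ≡-Reasoning)

private variable
  c d e e′ m n : ℕ

[_<_] : ℕ → ℕ → ℕ
[ m < n ] = if m <ᵇ n then 1 else 0

[<]-yes : m < n → [ m < n ] ≡ 1
[<]-yes {m} {n} m<n with m <ᵇ n | <⇒<ᵇ m<n
... | true | _ = refl

[<]-no : n ≤ m → [ m < n ] ≡ 0
[<]-no {n} {m} n≤m with m <ᵇ n | <ᵇ⇒< m n
... | false | _   = refl
... | true  | sound = ⊥-elim (<⇒≱ (sound _) n≤m)

[<]≤1 : ∀ m n → [ m < n ] ≤ 1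
[<]≤1 m n with m <ᵇ n
... | true  = ≤-refl
... | false = z≤n

divMod-unique : ∀ {q r n L} .{{_ : NonZero q}} → r < q → n ≡ r + L * q → n % q ≡ r × n / q ≡ L
divMod-unique {q} {r} {n} {L} r<q refl =
    trans ([m+kn]%n≡m%n r L q) (m<n⇒m%n≡m r<q)
  , (begin
      (r + L * q) / q     ≡⟨ +-distrib-/-∣ʳ r (divides-refl L) ⟩
      r / q + L * q / q   ≡⟨ cong₂ _+_ (m<n⇒m/n≡0 r<q) (m*n/n≡m L q) ⟩
      L                   ∎)
  where open ≡-Reasoning

+-%-/-noCarry : ∀ {q} .{{_ : NonZero q}} → n % q + d < q →
                (n + d) % q ≡ n % q + d × (n + d) / q ≡ n / q
+-%-/-noCarry {n} {d} {q} lt = divMod-unique lt (begin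
  n + d                     ≡⟨ cong (_+ d) (m≡m%n+[m/n]*n n q) ⟩
  n % q + n / q * q + d     ≡⟨ regroup (n % q) (n / q * q) d ⟩
  n % q + d + n / q * q     ∎)
  where
  open ≡-Reasoning
  regroup : ∀ a b c → a + b + c ≡ a + c + b
  regroup = solve-∀

+-%-/-carry : ∀ {q} .{{_ : NonZero q}} → q ≤ n % q + d → d ≤ q →
              (n + d) % q ≡ n % q + d ∸ q × (n + d) / q ≡ suc (n / q)
+-%-/-carry {n} {d} {q} q≤ d≤q = divMod-unique lt (begin
  n + d                            ≡⟨ cong (_+ d) (m≡m%n+[m/n]*n n q) ⟩
  n % q + n / q * q + d            ≡⟨ regroup (n % q) (n / q * q) d ⟩
  (n % q + d) + n / q * q          ≡⟨ cong (_+ n / q * q) (m∸n+n≡m q≤) ⟨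
  (n % q + d ∸ q) + q + n / q * q  ≡⟨ +-assoc (n % q + d ∸ q) q (n / q * q) ⟩
  n % q + d ∸ q + suc (n / q) * q  ∎)
  where
  open ≡-Reasoning
  regroup : ∀ a b c → a + b + c ≡ a + c + b
  regroup = solve-∀
  lt : n % q + d ∸ q < q
  lt = +-cancelʳ-< q (n % q + d ∸ q) q
         (subst (_< q + q) (sym (m∸n+n≡m q≤)) (+-mono-<-≤ (m%n<n n q) d≤q))

double+bit-injective : e ≤ 1 → e′ ≤ 1 → 2 * m + e ≡ 2 * n + e′ → m ≡ n × e ≡ e′
double+bit-injective {e} {e′} {m} {n} e≤1 e′≤1 eq =
    trans (sym (proj₂ (halve m e≤1))) (trans (cong (_/ 2) eq) (proj₂ (halve n e′≤1)))
  , trans (sym (proj₁ (halve m e≤1))) (trans (cong (_% 2) eq) (proj₁ (halve n e′≤1)))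
  where
  halve : ∀ {e} m → e ≤ 1 → (2 * m + e) % 2 ≡ e × (2 * m + e) / 2 ≡ m
  halve {e} m e≤1 = divMod-unique (s≤s e≤1) (as-divMod e m)
    where
    as-divMod : ∀ e m → 2 * m + e ≡ e + m * 2
    as-divMod = solve-∀

next-lap⇒gap : ∀ {q} .{{_ : NonZero q}} n c d → (n + c) / q ≡ suc ((n + d) / q) → d + (n + c) % q < c
next-lap⇒gap {q} n c d laps = +-cancelʳ-< (rB + X) (d + rA) c (begin-strict
  d + rA + (rB + X)  <⟨ +-monoʳ-< (d + rA) (+-monoˡ-< X (m%n<n (n + d) q)) ⟩
  d + rA + (q + X)   ≡⟨ regroup₁ n d rA q (l * q) ⟩
  (n + d) + (rA + suc l * q)  ≡⟨ cong₂ _+_ eqB (sym eqA) ⟩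
  (rB + l * q) + (n + c)      ≡⟨ regroup₂ n c rB (l * q) ⟩
  c + (rB + X)       ∎)
  where
  open ≤-Reasoning
  rA rB l X : ℕ
  rA = (n + c) % q
  rB = (n + d) % q
  l  = (n + d) / q
  X  = n + l * q
  eqA : n + c ≡ rA + suc l * q
  eqA = trans (m≡m%n+[m/n]*n (n + c) q) (cong (λ l → rA + l * q) laps)
  eqB : n + d ≡ rB + l * q
  eqB = m≡m%n+[m/n]*n (n + d) q
  regroup₁ : ∀ n d rA q Lq → d + rA + (q + (n + Lq)) ≡ (n + d) + (rA + (q + Lq))
  regroup₁ = solve-∀
  regroup₂ : ∀ n c rB Lq → (rB + Lq) + (n + c) ≡ c + (rB + (n + Lq))
  regroup₂ = solve-∀

memAux-complete : ∀ {q} .{{_ : NonZero q}} s k x i → i < k → red q (s + i) ≡ x → memAux q s k x ≡ true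
memAux-complete {q} s (suc k) x i i<1+k hit with i ≟ k
... | yes refl = cong (_∨ memAux q s k x) (≡⇒≡ᵇ-true hit)
  where
  ≡⇒≡ᵇ-true : ∀ {m n} → m ≡ n → (m ≡ᵇ n) ≡ true
  ≡⇒≡ᵇ-true {m} {n} m≡n = Equivalence.to T-≡ (≡⇒≡ᵇ m n m≡n)
... | no i≢k = trans (cong ((red q (s + k) ≡ᵇ x) ∨_) earlier) (∨-zeroʳ _)
  where
  earlier : memAux q s k x ≡ true
  earlier = memAux-complete s k x i (≤∧≢⇒< (s≤s⁻¹ i<1+k) i≢k) hit

memAux-sound : ∀ {q} .{{_ : NonZero q}} s k x → memAux q s k x ≡ true → ∃[ i ] i < k × red q (s + i) ≡ x
memAux-sound {q} s (suc k) x found with red q (s + k) ≡ᵇ x in hit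
... | true  = k , ≤-refl , ≡ᵇ⇒≡ _ _ (Equivalence.from T-≡ hit)
... | false with memAux-sound s k x found
...   | i , i<k , red≡x = i , m<n⇒m<1+n i<k , red≡x

red-+1 : ∀ {q} .{{_ : NonZero q}} s i → red q (s + 1 + i) ≡ suc ((s + i) % q)
red-+1 {q} s i = cong (λ n → suc (n % q)) (cong (_∸ 1) (shift s i))
  where
  shift : ∀ s i → s + 1 + i ≡ suc (s + i)
  shift = solve-∀

module _ {p q b : ℕ} .{{_ : NonZero q}} {k x : ℕ} where

  occ-∈ : InBracket p q b (suc k) x → occ p q b (suc k) x ≡ suc (occ p q b k x)
  occ-∈ x∈ rewrite x∈ = refl

  occ-∉ : ¬ InBracket p q b (suc k) x → occ p q b (suc k) x ≡ occ p q b k x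
  occ-∉ x∉ rewrite ¬-not x∉ = refl

same-block⇒close : [ c < m ] ≡ [ d < m ] → c < m + m → c < d + m
same-block⇒close {c} {m} {d} same c<2m with c <? m
... | yes c<m = <-≤-trans c<m (m≤n+m m d)
... | no c≮m  = <-≤-trans c<2m (+-monoˡ-≤ m m≤d)
  where
  m≤d : m ≤ d
  m≤d = ≮⇒≥ λ d<m → 0≢1+n (trans (sym ([<]-no (≮⇒≥ c≮m))) (trans same ([<]-yes d<m)))

module Control (p b : ℕ) .{{_ : NonZero (p + 2 * b)}} where

  q : ℕ
  q = p + 2 * b

  2b≡b+b : 2 * b ≡ b + b
  2b≡b+b = cong (b +_) (+-identityʳ b)

  b≤2b : b ≤ 2 * b
  b≤2b = m≤m+n b (b + 0)

  +b<2b : m < b → m + b < 2 * b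
  +b<2b {m} m<b = subst (m + b <_) (sym 2b≡b+b) (+-monoˡ-< b m<b)

  2b≤+b : b ≤ m → 2 * b ≤ m + b
  2b≤+b {m} b≤m = subst (_≤ m + b) (sym 2b≡b+b) (+-monoˡ-≤ b b≤m)

  2b≤q : 2 * b ≤ q
  2b≤q = m≤n+m (2 * b) p

  b≤q : b ≤ q
  b≤q = ≤-trans b≤2b 2b≤q

  module Complement (x′ c : ℕ) (x+c≡q : suc x′ + c ≡ q) where

    x : ℕ
    x = suc x′

    x′<q : x′ < q
    x′<q = subst (x′ <_) x+c≡q (s≤s (m≤m+n x′ c))

    c<q : c < q
    c<q = subst (c <_) x+c≡q (s≤s (m≤n+m c x′))

    offset pos lap : ℕ → ℕ
    offset k = k * b + c
    pos k = offset k % q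
    lap k = offset k / q

    offset≡ : ∀ k → offset k ≡ pos k + lap k * q
    offset≡ k = m≡m%n+[m/n]*n (offset k) q

    2b≤pos⇒∈β : ∀ k → 2 * b ≤ pos k → InBracket p q b (suc k) x
    2b≤pos⇒∈β k 2b≤r =
      memAux-complete (k * b + 1) p x i i<p (trans (red-+1 (k * b) i) (cong suc kb+i%q))
      where
      r l i : ℕ
      r = pos k
      l = lap k
      i = q ∸ suc r
      i+1+r≡q : i + suc r ≡ q
      i+1+r≡q = m∸n+n≡m (m%n<n (offset k) q)
      i<p : i < p
      i<p = +-cancelʳ-≤ (2 * b) (suc i) p (begin
        suc i + 2 * b  ≤⟨ +-monoʳ-≤ (suc i) 2b≤r ⟩
        suc i + r      ≡⟨ +-suc i r ⟨
        i + suc r      ≡⟨ i+1+r≡q ⟩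
        p + 2 * b      ∎)
        where open ≤-Reasoning
      kb+i≡ : k * b + i ≡ x′ + l * q
      kb+i≡ = +-cancelʳ-≡ (c + suc r) (k * b + i) (x′ + l * q) (begin
        k * b + i + (c + suc r)    ≡⟨ regroup₁ (k * b) i c (suc r) ⟩
        offset k + (i + suc r)     ≡⟨ cong₂ _+_ (offset≡ k) i+1+r≡q ⟩
        r + l * q + q              ≡⟨ cong (r + l * q +_) x+c≡q ⟨
        r + l * q + (x + c)        ≡⟨ regroup₂ x′ c r (l * q) ⟩
        x′ + l * q + (c + suc r)   ∎)
        where
        open ≡-Reasoning
        regroup₁ : ∀ s i c r → s + i + (c + r) ≡ (s + c) + (i + r)
        regroup₁ = solve-∀
        regroup₂ : ∀ x′ c r lq → r + lq + (suc x′ + c) ≡ x′ + lq + (c + suc r)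
        regroup₂ = solve-∀
      kb+i%q : (k * b + i) % q ≡ x′
      kb+i%q = trans (cong (_% q) kb+i≡) (trans ([m+kn]%n≡m%n x′ l q) (m<n⇒m%n≡m x′<q))

    ∈β⇒2b≤pos : ∀ k → InBracket p q b (suc k) x → 2 * b ≤ pos k
    ∈β⇒2b≤pos k x∈ with memAux-sound (k * b + 1) p x x∈
    ... | i , i<p , red≡x = +-cancelʳ-≤ p (2 * b) r (begin
        2 * b + p     ≡⟨ +-comm (2 * b) p ⟩
        q             ≤⟨ q≤r+1+i ⟩
        r + suc i     ≤⟨ +-monoʳ-≤ r i<p ⟩
        r + p         ∎)
      where
      open ≤-Reasoning
      r l M : ℕ
      r = pos k
      l = lap k
      M = (k * b + i) / q
      kb+i%q : (k * b + i) % q ≡ x′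
      kb+i%q = suc-injective (trans (sym (red-+1 (k * b) i)) red≡x)
      r+1+i≡ : r + suc i + l * q ≡ suc M * q
      r+1+i≡ = begin-equality
        r + suc i + l * q               ≡⟨ regroup₁ r i (l * q) ⟩
        r + l * q + suc i               ≡⟨ cong (_+ suc i) (offset≡ k) ⟨
        offset k + suc i                ≡⟨ regroup₂ (k * b) c i ⟩
        k * b + i + suc c               ≡⟨ cong (_+ suc c) (m≡m%n+[m/n]*n (k * b + i) q) ⟩
        (k * b + i) % q + M * q + suc c ≡⟨ cong (λ y → y + M * q + suc c) kb+i%q ⟩
        x′ + M * q + suc c              ≡⟨ regroup₃ x′ (M * q) c ⟩
        x + c + M * q                   ≡⟨ cong (_+ M * q) x+c≡q ⟩
        suc M * q                       ∎
        where
        regroup₁ : ∀ r i lq → r + suc i + lq ≡ r + lq + suc i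
        regroup₁ = solve-∀
        regroup₂ : ∀ s c i → s + c + suc i ≡ s + i + suc c
        regroup₂ = solve-∀
        regroup₃ : ∀ x′ mq c → x′ + mq + suc c ≡ suc x′ + c + mq
        regroup₃ = solve-∀
      r+1+i%q≡0 : (r + suc i) % q ≡ 0
      r+1+i%q≡0 = trans (sym ([m+kn]%n≡m%n (r + suc i) l q))
                        (trans (cong (_% q) r+1+i≡) (m*n%n≡0 (suc M) q))
      q≤r+1+i : q ≤ r + suc i
      q≤r+1+i = ≮⇒≥ λ r+1+i<q →
        1+n≢0 (trans (trans (sym (+-suc r i)) (sym (m<n⇒m%n≡m r+1+i<q))) r+1+i%q≡0)

    pos₀ : pos 0 ≡ c
    pos₀ = proj₁ (divMod-unique {L = 0} c<q (sym (+-identityʳ c)))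

    lap₀ : lap 0 ≡ 0
    lap₀ = proj₂ (divMod-unique {L = 0} c<q (sym (+-identityʳ c)))

    [pos₀<b]≡0 : b ≤ c → [ pos 0 < b ] ≡ 0
    [pos₀<b]≡0 b≤c = trans (cong [_< b ] pos₀) ([<]-no b≤c)

    occ-hit : ∀ k → 2 * b ≤ pos k → occ p q b (suc k) x ≡ suc (occ p q b k x)
    occ-hit k hit = occ-∈ {p} {q} {b} {k} {x} (2b≤pos⇒∈β k hit)

    occ-miss : ∀ k → pos k < 2 * b → occ p q b (suc k) x ≡ occ p q b k x
    occ-miss k miss = occ-∉ {p} {q} {b} {k} {x} (λ x∈ → <⇒≱ miss (∈β⇒2b≤pos k x∈))

    offset-suc : ∀ k → offset (suc k) ≡ offset k + b
    offset-suc k = shift b (k * b) c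
      where
      shift : ∀ b kb c → b + kb + c ≡ kb + c + b
      shift = solve-∀

    pos-lap-noCarry : ∀ k → pos k + b < q → pos (suc k) ≡ pos k + b × lap (suc k) ≡ lap k
    pos-lap-noCarry k lt =
      subst (λ n → n % q ≡ pos k + b × n / q ≡ lap k) (sym (offset-suc k)) (+-%-/-noCarry lt)

    pos-lap-carry : ∀ k → q ≤ pos k + b → pos (suc k) ≡ pos k + b ∸ q × lap (suc k) ≡ suc (lap k)
    pos-lap-carry k q≤ =
      subst (λ n → n % q ≡ pos k + b ∸ q × n / q ≡ suc (lap k)) (sym (offset-suc k))
            (+-%-/-carry q≤ b≤q)

    -- [ pos k < b ] is 1 while the current wrap has cost only the first of its two misses.
    Balanced : ℕ → Set
    Balanced k = occ p q b (suc k) x + 2 * lap k + [ c < 2 * b ] ≡ [ pos k < b ] + suc k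

    balanced-by : ∀ {k o l e e′} → occ p q b (suc k) x ≡ o → lap k ≡ l → [ c < 2 * b ] ≡ e →
                  [ pos k < b ] ≡ e′ → o + 2 * l + e ≡ e′ + suc k → Balanced k
    balanced-by refl refl refl refl balance = balance

    balanced-noCarry : ∀ k → pos k + b < q → Balanced k → Balanced (suc k)
    balanced-noCarry k noCarry balance with pos-lap-noCarry k noCarry | pos k <? b
    ... | pos′ , lap′ | yes r<b = balanced-by
          (occ-miss (suc k) (subst (_< 2 * b) (sym pos′) (+b<2b r<b)))
          lap′ refl ([<]-no (subst (b ≤_) (sym pos′) (m≤n+m b (pos k))))
          (trans balance (cong (_+ suc k) ([<]-yes r<b)))
    ... | pos′ , lap′ | no r≮b = balanced-by
          (occ-hit (suc k) (subst (2 * b ≤_) (sym pos′) (2b≤+b (≮⇒≥ r≮b))))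
          lap′ refl ([<]-no (subst (b ≤_) (sym pos′) (m≤n+m b (pos k))))
          (cong suc (trans balance (cong (_+ suc k) ([<]-no (≮⇒≥ r≮b)))))

    balanced-carry : ∀ k → q ≤ pos k + b → Balanced k → Balanced (suc k)
    balanced-carry k carry balance with pos-lap-carry k carry
    ... | pos′ , lap′ = balanced-by
          (occ-miss (suc k) (subst (_< 2 * b) (sym pos′) (<-≤-trans r′<b b≤2b)))
          lap′ refl ([<]-yes (subst (_< b) (sym pos′) r′<b))
          (trans (two-more o (lap k) [ c < 2 * b ])
                 (cong (2 +_) (trans balance (cong (_+ suc k) ([<]-no b≤r)))))
      where
      o : ℕ
      o = occ p q b (suc k) x
      r′<b : pos k + b ∸ q < b
      r′<b = subst (pos k + b ∸ q <_) (m+n∸m≡n q b)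
                   (∸-monoˡ-< (+-monoˡ-< b (m%n<n (offset k) q)) carry)
      b≤r : b ≤ pos k
      b≤r = +-cancelʳ-≤ b b (pos k) (≤-trans (subst (_≤ q) 2b≡b+b 2b≤q) carry)
      two-more : ∀ o l e → o + 2 * suc l + e ≡ 2 + (o + 2 * l + e)
      two-more = solve-∀

    balanced : b ≤ c → ∀ k → Balanced k
    balanced b≤c zero with c <? 2 * b
    ... | yes c<2b = balanced-by (occ-miss 0 (subst (_< 2 * b) (sym pos₀) c<2b))
                                 lap₀ ([<]-yes c<2b) ([pos₀<b]≡0 b≤c) refl
    ... | no c≮2b  = balanced-by (occ-hit 0 (subst (2 * b ≤_) (sym pos₀) (≮⇒≥ c≮2b)))
                                 lap₀ ([<]-no (≮⇒≥ c≮2b)) ([pos₀<b]≡0 b≤c) refl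
    balanced b≤c (suc k) with pos k + b <? q
    ... | yes noCarry = balanced-noCarry k noCarry (balanced b≤c k)
    ... | no carry    = balanced-carry k (≮⇒≥ carry) (balanced b≤c k)

    balanced-∈ : b ≤ c → ∀ k → InBracket p q b (suc k) x →
                 occ p q b (suc k) x + 2 * lap k + [ c < 2 * b ] ≡ suc k
    balanced-∈ b≤c k x∈ =
      trans (balanced b≤c k) (cong (_+ suc k) ([<]-no (≤-trans b≤2b (∈β⇒2b≤pos k x∈))))

  theSet-bounds : ∀ {x} → TheSet p b x → p ∸ 2 * b < x × x + b ≤ q
  theSet-bounds {x} (inj₁ (lo , hi)) =
    subst (_≤ x) (+-comm (p ∸ 2 * b) 1) lo , +-mono-≤ hi b≤2b
  theSet-bounds {x} (inj₂ (lo , hi)) =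
      <-≤-trans (s≤s (m∸n≤m p (2 * b))) (subst (_≤ x) (+-comm p 1) lo)
    , subst (x + b ≤_) (trans (+-assoc p b b) (cong (p +_) (sym 2b≡b+b))) (+-monoˡ-≤ b hi)

  complement : ∀ {x} → p ∸ 2 * b < x → x + b ≤ q →
               ∃[ x′ ] ∃[ c ] x ≡ suc x′ × suc x′ + c ≡ q × b ≤ c × c < 2 * b + 2 * b
  complement {suc x′} lo x+b≤q =
    x′ , q ∸ x , refl , m+[n∸m]≡n x≤q , m+n≤o⇒m≤o∸n b (subst (_≤ q) (+-comm x b) x+b≤q) , c<4b
    where
    x : ℕ
    x = suc x′
    x≤q : x ≤ q
    x≤q = m+n≤o⇒m≤o x x+b≤q
    q<x+4b : q < x + (2 * b + 2 * b)
    q<x+4b = begin-strict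
      p + 2 * b                    ≤⟨ +-monoˡ-≤ (2 * b) (m≤n+m∸n p (2 * b)) ⟩
      2 * b + (p ∸ 2 * b) + 2 * b  <⟨ +-monoˡ-< (2 * b) (+-monoʳ-< (2 * b) lo) ⟩
      2 * b + x + 2 * b            ≡⟨ regroup (2 * b) x ⟩
      x + (2 * b + 2 * b)          ∎
      where
      open ≤-Reasoning
      regroup : ∀ m x → m + x + m ≡ x + (m + m)
      regroup = solve-∀
    c<4b : q ∸ x < 2 * b + 2 * b
    c<4b = subst (q ∸ x <_) (m+n∸m≡n x (2 * b + 2 * b)) (∸-monoˡ-< q<x+4b x≤q)

  consistent : ∀ x y k → TheSet p b x → TheSet p b y → ¬ InContradiction p q b (suc k) x y
  consistent x y k Sx Sy (x∈ , y∈ , occ≡)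
    with uncurry complement (theSet-bounds Sx) | uncurry complement (theSet-bounds Sy)
  ... | x′ , c , refl , x+c≡q , b≤c , c<4b | y′ , d , refl , y+d≡q , b≤d , _ = <-asym far close
    where
    module X = Complement x′ c x+c≡q
    module Y = Complement y′ d y+d≡q
    o : ℕ
    o = occ p q b (suc k) x
    laps : X.lap k ≡ suc (Y.lap k) × [ c < 2 * b ] ≡ [ d < 2 * b ]
    laps = double+bit-injective ([<]≤1 c (2 * b)) ([<]≤1 d (2 * b)) (+-cancelˡ-≡ o _ _ (begin
      o + (2 * X.lap k + [ c < 2 * b ])         ≡⟨ +-assoc o (2 * X.lap k) _ ⟨
      o + 2 * X.lap k + [ c < 2 * b ]           ≡⟨ X.balanced-∈ b≤c k x∈ ⟩
      suc k                                     ≡⟨ Y.balanced-∈ b≤d k y∈ ⟨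
      oy + 2 * Y.lap k + [ d < 2 * b ]          ≡⟨ cong (λ o′ → o′ + 2 * Y.lap k + [ d < 2 * b ]) occ≡ ⟩
      o + 2 + 2 * Y.lap k + [ d < 2 * b ]       ≡⟨ regroup o (Y.lap k) [ d < 2 * b ] ⟩
      o + (2 * suc (Y.lap k) + [ d < 2 * b ])   ∎))
      where
      open ≡-Reasoning
      oy : ℕ
      oy = occ p q b (suc k) y
      regroup : ∀ o l e → o + 2 + 2 * l + e ≡ o + (2 * suc l + e)
      regroup = solve-∀
    far : d + 2 * b < c
    far = ≤-<-trans (+-monoʳ-≤ d (X.∈β⇒2b≤pos k x∈)) (next-lap⇒gap (k * b) c d (proj₁ laps))
    close : c < d + 2 * b
    close = same-block⇒close {m = 2 * b} (proj₂ laps) c<4b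

lemma15 : (p q b : ℕ) → .{{_ : NonZero q}} → 1 ≤ p → p < q → q ≡ p + 2 * b → 2 * b ≤ p →
    Consistent p q b (TheSet p b)
lemma15 p .(p + 2 * b) b _ _ refl _ x y zero    _  _  ()
lemma15 p .(p + 2 * b) b _ _ refl _ x y (suc k) Sx Sy _  = Control.consistent p b x y k Sx Sy
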